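{- Let $k,n$ be integers with $k\geq 1$ and $n\geq k+3$, and let $u$ be the natural number with base-$4$ expansion $(u)_4=1\,3^{(k)}\,2\,3^{(n)}$. Then $s_4(u^2)=3n$ and $s_4(u)=3+3(k+n)$.
   Context: $s_4(n)$ denotes the sum of the digits of $n$ in base $4$. In a digit string, $x^{(a)}$ denotes the digit $x$ repeated $a$ times consecutively, read from most to least significant digit; so $(u)_4$ is a $1$, then $k$ digits $3$, then a $2$, then $n$ digits $3$. -}

module Defs where

open import Data.Nat using (ℕ; zero; suc; _+_; _*_)
open import Data.Nat.DivMod using (_/_; _%_)
open import Data.List using (List; []; _∷_; _++_; replicate; foldl)

-- digit sum in base 4, computed with a fuel parameter;
-- fuel m ≥ m is always enough since m / 4 < m for m > 0.
s4-fuel : ℕ → ℕ → ℕ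
s4-fuel zero    m = 0
s4-fuel (suc f) m = m % 4 + s4-fuel f (m / 4)

s4 : ℕ → ℕ
s4 m = s4-fuel m m

fromDigits4 : List ℕ → ℕ
fromDigits4 = foldl (λ acc d → 4 * acc + d) 0

uDigits : ℕ → ℕ → List ℕ
uDigits k n = 1 ∷ replicate k 3 ++ (2 ∷ replicate n 3)

u : ℕ → ℕ → ℕ
u k n = fromDigits4 (uDigits k n)

module Submission where

-- Both numbers are written as explicit base-4 digit strings,
-- and for a string of genuine digits (each < 4) the digit sum s4 of its
-- value is just the sum of its digits.  For u this is immediate.  For u²,
-- writing n = k + 3 + t, one checks the identity
--   u² = (3^(k+1) 0^(k+2) 3^(t+1) 0^(k+1) 2 0^(k+2+t) 1)_4 ,
-- whose digits sum to 3n.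

open import Defs
open import Data.Nat using (ℕ; zero; suc; _+_; _*_; _≤_; _<_; _<ᵇ_; z≤n; s≤s; _%_; _/_)
open import Data.Bool using (T)
open import Data.Nat.Properties
open import Data.Nat.DivMod
open import Data.Nat.Divisibility using (divides)
open import Data.Nat.ListAction using (sum)
open import Data.Nat.ListAction.Properties using (sum-++)
open import Data.Nat.Tactic.RingSolver using (solve-∀)
open import Data.Product using (_×_; _,_; proj₁; proj₂)
open import Data.List using (List; []; _∷_; _++_; replicate; foldl)
open import Data.List.Properties using (foldl-++; ++-identityʳ)
open import Data.List.Relation.Unary.All using (All; []; _∷_)
open import Data.List.Relation.Unary.All.Properties using (++⁺; replicate⁺)
open import Relation.Binary.PropositionalEquality

s4-fuel-zero : ∀ f → s4-fuel f 0 ≡ 0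
s4-fuel-zero zero    = refl
s4-fuel-zero (suc f) = s4-fuel-zero f

-- Any two amounts of fuel that are at least the argument give the same
-- value, since each step strictly decreases a positive argument (m / 4 < m).
fuel-agree : ∀ f f' m → m ≤ f → m ≤ f' → s4-fuel f m ≡ s4-fuel f' m
fuel-agree zero    f'       zero z≤n _   = sym (s4-fuel-zero f')
fuel-agree (suc f) zero     zero _   z≤n = s4-fuel-zero (suc f)
fuel-agree (suc f) (suc f') m    m≤f m≤f' =
  cong (m % 4 +_) (fuel-agree f f' (m / 4) (quotient-≤ m≤f) (quotient-≤ m≤f'))
  where
  quotient-≤ : ∀ {m g} → m ≤ suc g → m / 4 ≤ g
  quotient-≤ {zero}  _         = z≤n
  quotient-≤ {suc m} (s≤s m≤g) = ≤-trans (≤-pred (m/n<m (suc m) 4 (s≤s (s≤s z≤n)))) m≤g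

s4-unfold : ∀ m → s4 m ≡ m % 4 + s4 (m / 4)
s4-unfold m = begin
  s4 m                       ≡⟨ fuel-agree m (suc m) m ≤-refl (n≤1+n m) ⟩
  m % 4 + s4-fuel m (m / 4)  ≡⟨ cong (m % 4 +_) (fuel-agree m (m / 4) (m / 4) (m/n≤m m 4) ≤-refl) ⟩
  m % 4 + s4 (m / 4)         ∎
  where open ≡-Reasoning

s4-snoc : ∀ m d → d < 4 → s4 (4 * m + d) ≡ s4 m + d
s4-snoc m d d<4 = begin
  s4 (4 * m + d)                          ≡⟨ cong s4 (trans (+-comm (4 * m) d) (cong (d +_) (*-comm 4 m))) ⟩
  s4 (d + m * 4)                          ≡⟨ s4-unfold (d + m * 4) ⟩
  (d + m * 4) % 4 + s4 ((d + m * 4) / 4)  ≡⟨ cong₂ (λ r q → r + s4 q) last-digit rest ⟩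
  d + s4 m                                ≡⟨ +-comm d (s4 m) ⟩
  s4 m + d                                ∎
  where
  open ≡-Reasoning
  last-digit : (d + m * 4) % 4 ≡ d
  last-digit = trans ([m+kn]%n≡m%n d m 4) (m<n⇒m%n≡m d<4)
  rest : (d + m * 4) / 4 ≡ m
  rest = begin
    (d + m * 4) / 4    ≡⟨ +-distrib-/-∣ʳ d (divides m refl) ⟩
    d / 4 + m * 4 / 4  ≡⟨ cong₂ _+_ (m<n⇒m/n≡0 d<4) (m*n/n≡m m 4) ⟩
    m                  ∎

pushDigit : ℕ → ℕ → ℕ
pushDigit acc d = 4 * acc + d

s4-foldl : ∀ acc ds → All (_< 4) ds → s4 (foldl pushDigit acc ds) ≡ s4 acc + sum ds
s4-foldl acc []       []           = sym (+-identityʳ (s4 acc))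
s4-foldl acc (d ∷ ds) (d<4 ∷ ds<4) = begin
  s4 (foldl pushDigit (pushDigit acc d) ds)  ≡⟨ s4-foldl (pushDigit acc d) ds ds<4 ⟩
  s4 (4 * acc + d) + sum ds                  ≡⟨ cong (_+ sum ds) (s4-snoc acc d d<4) ⟩
  s4 acc + d + sum ds                        ≡⟨ +-assoc (s4 acc) d (sum ds) ⟩
  s4 acc + (d + sum ds)                      ∎
  where open ≡-Reasoning

-- The repunit R m = (1^(m))_4.  Throughout, 1 + 3 * R m plays the role of 4 ^ m.
R : ℕ → ℕ
R zero    = 0
R (suc m) = 1 + 4 * R m

-- 1^(m + j) is 1^(m) followed by 1^(j).
R-+ : ∀ m j → R (m + j) ≡ R m + (1 + 3 * R m) * R j
R-+ zero    j = sym (+-identityʳ (R j))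
R-+ (suc m) j = trans (cong (λ r → 1 + 4 * r) (R-+ m j)) (shift (R m) (R j))
  where
  shift : ∀ a b → 1 + 4 * (a + (1 + 3 * a) * b) ≡ 1 + 4 * a + (1 + 3 * (1 + 4 * a)) * b
  shift = solve-∀

foldl-replicate : ∀ m d acc → foldl pushDigit acc (replicate m d) ≡ acc * (1 + 3 * R m) + d * R m
foldl-replicate zero    d acc = empty acc d
  where
  empty : ∀ acc d → acc ≡ acc * (1 + 3 * 0) + d * 0
  empty = solve-∀
foldl-replicate (suc m) d acc = trans (foldl-replicate m d (pushDigit acc d)) (step acc d (R m))
  where
  step : ∀ acc d r → (4 * acc + d) * (1 + 3 * r) + d * r ≡ acc * (1 + 3 * (1 + 4 * r)) + d * (1 + 4 * r)
  step = solve-∀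

Block : Set
Block = ℕ × ℕ

blocks : List Block → List ℕ
blocks []             = []
blocks ((m , d) ∷ bs) = replicate m d ++ blocks bs

blockSum : List Block → ℕ
blockSum []             = 0
blockSum ((m , d) ∷ bs) = m * d + blockSum bs

blockValue : ℕ → List Block → ℕ
blockValue acc []             = acc
blockValue acc ((m , d) ∷ bs) = blockValue (acc * (1 + 3 * R m) + d * R m) bs

DigitBlocks : List Block → Set
DigitBlocks = All (λ b → proj₂ b < 4)

digit : ∀ d → {d<4 : T (d <ᵇ 4)} → d < 4
digit d {d<4} = <ᵇ⇒< d 4 d<4

foldl-blocks : ∀ acc bs → foldl pushDigit acc (blocks bs) ≡ blockValue acc bs
foldl-blocks acc []             = refl
foldl-blocks acc ((m , d) ∷ bs) = begin
  foldl pushDigit acc (replicate m d ++ blocks bs)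
    ≡⟨ foldl-++ pushDigit acc (replicate m d) (blocks bs) ⟩
  foldl pushDigit (foldl pushDigit acc (replicate m d)) (blocks bs)
    ≡⟨ cong (λ a → foldl pushDigit a (blocks bs)) (foldl-replicate m d acc) ⟩
  foldl pushDigit (acc * (1 + 3 * R m) + d * R m) (blocks bs)
    ≡⟨ foldl-blocks _ bs ⟩
  blockValue acc ((m , d) ∷ bs)
    ∎
  where open ≡-Reasoning

sum-blocks : ∀ bs → sum (blocks bs) ≡ blockSum bs
sum-blocks []             = refl
sum-blocks ((m , d) ∷ bs) =
  trans (sum-++ (replicate m d) (blocks bs)) (cong₂ _+_ (sum-replicate m) (sum-blocks bs))
  where
  sum-replicate : ∀ m → sum (replicate m d) ≡ m * d
  sum-replicate zero    = refl
  sum-replicate (suc m) = cong (d +_) (sum-replicate m)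

all-blocks : ∀ bs → DigitBlocks bs → All (_< 4) (blocks bs)
all-blocks []             []           = []
all-blocks ((m , d) ∷ bs) (d<4 ∷ bs<4) = ++⁺ (replicate⁺ m d<4) (all-blocks bs bs<4)

s4-blockValue : ∀ bs → DigitBlocks bs → s4 (blockValue 0 bs) ≡ blockSum bs
s4-blockValue bs bs<4 = begin
  s4 (blockValue 0 bs)               ≡⟨ cong s4 (foldl-blocks 0 bs) ⟨
  s4 (foldl pushDigit 0 (blocks bs)) ≡⟨ s4-foldl 0 (blocks bs) (all-blocks bs bs<4) ⟩
  sum (blocks bs)                    ≡⟨ sum-blocks bs ⟩
  blockSum bs                        ∎
  where open ≡-Reasoning

uBlocks : ℕ → ℕ → List Block
uBlocks k n = (1 , 1) ∷ (k , 3) ∷ (1 , 2) ∷ (n , 3) ∷ []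

-- u is the value of its block string (the last block only differs by ++ []).
u-blocks : ∀ k n → u k n ≡ blockValue 0 (uBlocks k n)
u-blocks k n = trans (cong (λ s → fromDigits4 (1 ∷ replicate k 3 ++ (2 ∷ s))) (sym (++-identityʳ (replicate n 3))))
                     (foldl-blocks 0 (uBlocks k n))

squareBlocks : ℕ → ℕ → List Block
squareBlocks k t = (k + 1 , 3) ∷ (k + 2 , 0) ∷ (t + 1 , 3) ∷ (k + 1 , 0) ∷ (1 , 2) ∷ (k + (2 + t) , 0) ∷ (1 , 1) ∷ []

-- The squaring identity, written with a = R k and b = R t; every repunit
-- occurring in the two block strings is expanded by R-+.
square-identity : ∀ a b →
  let step = λ acc r d → acc * (1 + 3 * r) + d * r
      Rn   = a + (1 + 3 * a) * (1 + 4 * (1 + 4 * (1 + 4 * b)))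
      uVal = step (step (step (step 0 1 1) a 3) 1 2) Rn 3
  in uVal * uVal ≡
     step (step (step (step (step (step (step 0 (a + (1 + 3 * a) * 1) 3)
       (a + (1 + 3 * a) * 5) 0) (b + (1 + 3 * b) * 1) 3) (a + (1 + 3 * a) * 1) 0) 1 2)
       (a + (1 + 3 * a) * (1 + 4 * (1 + 4 * b))) 0) 1 1
square-identity = solve-∀

u-squared : ∀ k t → let n = k + (3 + t) in u k n * u k n ≡ blockValue 0 (squareBlocks k t)
u-squared k t rewrite u-blocks k (k + (3 + t))
                    | R-+ k (3 + t) | R-+ k 1 | R-+ k 2 | R-+ t 1 | R-+ k (2 + t)
  = square-identity (R k) (R t)

s4-u : ∀ k n → s4 (u k n) ≡ 3 + 3 * (k + n)
s4-u k n = begin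
  s4 (u k n)                       ≡⟨ cong s4 (u-blocks k n) ⟩
  s4 (blockValue 0 (uBlocks k n))  ≡⟨ s4-blockValue (uBlocks k n) digits ⟩
  blockSum (uBlocks k n)           ≡⟨ total k n ⟩
  3 + 3 * (k + n)                  ∎
  where
  open ≡-Reasoning
  digits : DigitBlocks (uBlocks k n)
  digits = digit 1 ∷ digit 3 ∷ digit 2 ∷ digit 3 ∷ []
  total : ∀ k n → 1 * 1 + (k * 3 + (1 * 2 + (n * 3 + 0))) ≡ 3 + 3 * (k + n)
  total = solve-∀

s4-u² : ∀ k t → let n = k + (3 + t) in s4 (u k n * u k n) ≡ 3 * n
s4-u² k t = begin
  s4 (u k n * u k n)                    ≡⟨ cong s4 (u-squared k t) ⟩
  s4 (blockValue 0 (squareBlocks k t))  ≡⟨ s4-blockValue (squareBlocks k t) digits ⟩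
  blockSum (squareBlocks k t)           ≡⟨ total k t ⟩
  3 * n                                 ∎
  where
  open ≡-Reasoning
  n = k + (3 + t)
  digits : DigitBlocks (squareBlocks k t)
  digits = digit 3 ∷ digit 0 ∷ digit 3 ∷ digit 0 ∷ digit 2 ∷ digit 0 ∷ digit 1 ∷ []
  total : ∀ k t → (k + 1) * 3 + ((k + 2) * 0 + ((t + 1) * 3 + ((k + 1) * 0
                  + (1 * 2 + ((k + (2 + t)) * 0 + (1 * 1 + 0)))))) ≡ 3 * (k + (3 + t))
  total = solve-∀

lemma3p8 : (k n : ℕ) → 1 ≤ k → k + 3 ≤ n →
    (s4 (u k n * u k n) ≡ 3 * n) × (s4 (u k n) ≡ 3 + 3 * (k + n))
lemma3p8 k n _ k+3≤n = subst (λ m → s4 (u k m * u k m) ≡ 3 * m) n≡ (s4-u² k t) , s4-u k n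
  where
  t : ℕ
  t = proj₁ (m≤n⇒∃[o]m+o≡n k+3≤n)
  n≡ : k + (3 + t) ≡ n
  n≡ = trans (sym (+-assoc k 3 t)) (proj₂ (m≤n⇒∃[o]m+o≡n k+3≤n))
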